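{- Let $\Pi$ be a strongly $\lambda$-extendible property on oriented graphs, with $\lambda=\frac{1}{2}$, and suppose $\Pi$ is hereditary. If the oriented triangle $\vec{K}_3$ belongs to $\Pi$, then the non-oriented triangle $\overset{\nrightarrow}{K}_3$ belongs to $\Pi$.
   Context: Here the graph class $\mathcal{G}$ is the class of oriented graphs (simple graphs each of whose edges is given a direction), without labels; $U(G)$ is the underlying simple graph. The oriented triangle $\vec{K}_3$ is the directed 3-cycle $v_1\to v_2\to v_3\to v_1$; the non-oriented triangle $\overset{\nrightarrow}{K}_3$ is the transitive tournament on $u_1,u_2,u_3$ with arcs $u_i\to u_j$ for $i<j$. A graph property $\Pi$ is a subset of $\mathcal{G}$ closed under isomorphism; it is hereditary if every vertex-induced subgraph of a graph in $\Pi$ is in $\Pi$. For $\lambda\in(0,1)$, $\Pi$ is strongly $\lambda$-extendible if: (inclusiveness) every $G\in\mathcal{G}$ with $U(G)\in\{K_1,K_2\}$ is in $\Pi$; (block additivity) $G\in\Pi$ iff every block of $G$ is in $\Pi$; (strong $\lambda$-subgraph extension) for every $G\in\mathcal{G}$ and every partition $(U,W)$ of $V(G)$ with $G[U],G[W]\in\Pi$, there is a set $F$ of edges between $U$ and $W$ with $|F|\geq\lambda|E(U,W)|$ such that $G-(E(U,W)\setminus F)\in\Pi$. -}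

module Defs where

open import Data.Nat using (ℕ; zero; suc; _+_; _*_; _≤_)
open import Data.Bool using (Bool; true; false; _∧_; _∨_; not; if_then_else_)
open import Data.Fin using (Fin; zero; suc)
open import Data.Fin.Subset using (Subset; _∈_; _⊆_; inside; outside)
open import Data.Vec using (Vec; []; _∷_; lookup; _[_]≔_)
open import Data.List using (List; map)
open import Data.Nat.ListAction using (sum)
open import Data.List using () renaming (allFin to finList)
open import Data.Product using (Σ; ∃; _×_; _,_; proj₁; proj₂)
open import Data.Sum using (_⊎_; inj₁; inj₂)
open import Function.Bundles using (_↔_; Inverse)
open import Relation.Binary.PropositionalEquality using (_≡_; _≢_; refl)

record OGraph : Set where
  field
    n      : ℕ
    arc    : Fin n → Fin n → Bool
    irrefl : ∀ v → arc v v ≡ false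
    asym   : ∀ u v → arc u v ≡ true → arc v u ≡ false
open OGraph public

Adj : (G : OGraph) → Fin (n G) → Fin (n G) → Set
Adj G u v = (arc G u v ≡ true) ⊎ (arc G v u ≡ true)

Iso : OGraph → OGraph → Set
Iso G H = Σ (Fin (n G) ↔ Fin (n H)) λ σ →
  ∀ u v → arc H (Inverse.to σ u) (Inverse.to σ v) ≡ arc G u v

size : ∀ {m} → Subset m → ℕ
size []            = zero
size (true  ∷ S)   = suc (size S)
size (false ∷ S)   = size S

select : ∀ {m} (S : Subset m) → Fin (size S) → Fin m
select (true  ∷ S) zero    = zero
select (true  ∷ S) (suc i) = suc (select S i)
select (false ∷ S) i       = suc (select S i)

-- induced subgraph along an arbitrary map (used with injective maps)
induceBy : (G : OGraph) {k : ℕ} → (Fin k → Fin (n G)) → OGraph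
induceBy G {k} ι = record
  { n      = k
  ; arc    = λ u v → arc G (ι u) (ι v)
  ; irrefl = λ v → irrefl G (ι v)
  ; asym   = λ u v → asym G (ι u) (ι v)
  }

induced : (G : OGraph) → Subset (n G) → OGraph
induced G S = induceBy G (select S)

GraphProperty : Set₁
GraphProperty = OGraph → Set

IsoClosed : GraphProperty → Set
IsoClosed Π = ∀ G H → Iso G H → Π G → Π H

Hereditary : GraphProperty → Set
Hereditary Π = ∀ G (S : Subset (n G)) → Π G → Π (induced G S)

data PathIn (G : OGraph) (B : Subset (n G)) (u : Fin (n G)) : Fin (n G) → Set where
  here : u ∈ B → PathIn G B u u
  step : ∀ {v w} → PathIn G B u v → Adj G v w → w ∈ B → PathIn G B u w

ConnectedOn : (G : OGraph) → Subset (n G) → Set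
ConnectedOn G B = ∀ u v → u ∈ B → v ∈ B → PathIn G B u v

NonSeparableOn : (G : OGraph) → Subset (n G) → Set
NonSeparableOn G B =
  ConnectedOn G B × (∀ x → x ∈ B → ConnectedOn G (B [ x ]≔ outside))

-- B is (the vertex set of) a block of G; blocks are induced subgraphs
IsBlock : (G : OGraph) → Subset (n G) → Set
IsBlock G B =
  (∃ λ v → v ∈ B) × NonSeparableOn G B ×
  (∀ Q → B ⊆ Q → NonSeparableOn G Q → Q ⊆ B)

countPairs : (m : ℕ) → (Fin m → Fin m → Bool) → ℕ
countPairs m P =
  sum (map (λ u → sum (map (λ v → if P u v then 1 else 0) (finList m))) (finList m))

crossing : (G : OGraph) → Subset (n G) → Fin (n G) → Fin (n G) → Bool
crossing G U u v = arc G u v ∧ not (lookup U u ∧ lookup U v) ∧ (lookup U u ∨ lookup U v)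

-- G - (E(U,W) ∖ F), where F is the set of crossing arcs u → v with keep u v = true
deleteCrossing : (G : OGraph) → Subset (n G) → (Fin (n G) → Fin (n G) → Bool) → OGraph
deleteCrossing G U keep = record
  { n      = n G
  ; arc    = λ u v → arc G u v ∧ (not (crossing G U u v) ∨ keep u v)
  ; irrefl = λ v → irr v
  ; asym   = as
  }
  where
  irr : ∀ v → (arc G v v ∧ (not (crossing G U v v) ∨ keep v v)) ≡ false
  irr v with arc G v v | irrefl G v
  ... | false | refl = refl
  as : ∀ u v → (arc G u v ∧ (not (crossing G U u v) ∨ keep u v)) ≡ true →
       (arc G v u ∧ (not (crossing G U v u) ∨ keep v u)) ≡ false
  as u v h with arc G v u in e
  ... | false = refl
  ... | true with arc G u v | asym G v u e
  as u v () | true | false | refl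

keptCount : (G : OGraph) → Subset (n G) → (Fin (n G) → Fin (n G) → Bool) → ℕ
keptCount G U keep = countPairs (n G) (λ u v → crossing G U u v ∧ keep u v)

crossCount : (G : OGraph) → Subset (n G) → ℕ
crossCount G U = countPairs (n G) (crossing G U)

complement : ∀ {m} → Subset m → Subset m
complement []      = []
complement (b ∷ S) = not b ∷ complement S

Inclusive : GraphProperty → Set
Inclusive Π =
  (∀ G → n G ≡ 1 → Π G) ×
  (∀ G → n G ≡ 2 → (∀ u v → u ≢ v → Adj G u v) → Π G)

BlockAdditive : GraphProperty → Set
BlockAdditive Π =
  ∀ G → (Π G → ∀ B → IsBlock G B → Π (induced G B)) ×
        ((∀ B → IsBlock G B → Π (induced G B)) → Π G)

StrongHalfSubgraphExtension : GraphProperty → Set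
StrongHalfSubgraphExtension Π =
  ∀ G (U : Subset (n G)) → Π (induced G U) → Π (induced G (complement U)) →
  Σ (Fin (n G) → Fin (n G) → Bool) λ keep →
    (crossCount G U ≤ 2 * keptCount G U keep) × Π (deleteCrossing G U keep)

StronglyHalfExtendible : GraphProperty → Set
StronglyHalfExtendible Π =
  IsoClosed Π × Inclusive Π × BlockAdditive Π × StrongHalfSubgraphExtension Π

cycArc : Fin 3 → Fin 3 → Bool
cycArc zero (suc zero)       = true
cycArc (suc zero) (suc (suc zero)) = true
cycArc (suc (suc zero)) zero = true
cycArc _ _                   = false

-- non-oriented (transitive) triangle: i → j for i < j
transArc : Fin 3 → Fin 3 → Bool
transArc zero (suc zero)       = true
transArc zero (suc (suc zero)) = true
transArc (suc zero) (suc (suc zero)) = true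
transArc _ _                   = false

orientedTriangle : OGraph
orientedTriangle = record
  { n = 3 ; arc = cycArc ; irrefl = irr ; asym = as }
  where
  irr : ∀ v → cycArc v v ≡ false
  irr zero = refl
  irr (suc zero) = refl
  irr (suc (suc zero)) = refl
  as : ∀ u v → cycArc u v ≡ true → cycArc v u ≡ false
  as zero (suc zero) _ = refl
  as (suc zero) (suc (suc zero)) _ = refl
  as (suc (suc zero)) zero _ = refl
  as zero zero ()
  as zero (suc (suc zero)) ()
  as (suc zero) zero ()
  as (suc zero) (suc zero) ()
  as (suc (suc zero)) (suc zero) ()
  as (suc (suc zero)) (suc (suc zero)) ()

nonOrientedTriangle : OGraph
nonOrientedTriangle = record
  { n = 3 ; arc = transArc ; irrefl = irr ; asym = as }
  where
  irr : ∀ v → transArc v v ≡ false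
  irr zero = refl
  irr (suc zero) = refl
  irr (suc (suc zero)) = refl
  as : ∀ u v → transArc u v ≡ true → transArc v u ≡ false
  as zero (suc zero) _ = refl
  as zero (suc (suc zero)) _ = refl
  as (suc zero) (suc (suc zero)) _ = refl
  as zero zero ()
  as (suc zero) zero ()
  as (suc zero) (suc zero) ()
  as (suc (suc zero)) zero ()
  as (suc (suc zero)) (suc zero) ()
  as (suc (suc zero)) (suc (suc zero)) ()

-- Let C be the cone over the oriented triangle: a new apex
-- vertex 0 with arcs 0 → v to each vertex v of the cycle 1 → 2 → 3 → 1.
-- Partition V(C) into U = {0} and W = {1,2,3}: C[U] is a single vertex
-- (in Π by inclusiveness) and C[W] is the oriented triangle (in Π by
-- assumption and isomorphism closure).  The strong 1/2-subgraph extension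
-- keeps a set F of apex arcs with 2|F| ≥ 3, so two apex arcs 0 → a and
-- 0 → b survive.  The triangle vertices a, b are joined by an arc, say
-- a → b, so the graph on {0, a, b} is transitive; by heredity and
-- isomorphism closure the transitive triangle is in Π.
module Submission where

open import Defs
open import Data.Nat using (ℕ; zero; suc; _≤_; _*_; s≤s)
open import Data.Nat.Properties using (+-identityʳ)
open import Data.Nat.ListAction using (sum)
open import Data.Bool using (Bool; true; false; if_then_else_)
open import Data.Fin using (Fin; zero; suc; _≟_)
open import Data.Fin.Subset using (Subset; ⁅_⁆)
open import Data.List using (List; []; _∷_; map)
open import Data.Vec using (_∷_; [])
open import Data.Product using (∃; _×_; _,_)
open import Data.Sum using (_⊎_; inj₁; inj₂)
open import Data.Empty using (⊥-elim)
open import Function.Bundles using (_↔_; Inverse; Injection; mk↔ₛ′)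
open import Function.Construct.Identity using (↔-id)
open import Function.Properties.Inverse using (↔⇒↣)
open import Relation.Nullary using (yes; no)
open import Relation.Binary.PropositionalEquality
  using (_≡_; _≢_; refl; sym; subst; subst₂)

Tournament : OGraph → Set
Tournament T = ∀ a b → a ≢ b → Adj T a b

-- If π relabels the vertices of a tournament T and ι sends every arc of T
-- (read through π) to an arc of G, then the subgraph of G induced along ι
-- is isomorphic to T: the missing arcs are forced by irreflexivity and
-- asymmetry of G.
tournamentEmbedding : (T G : OGraph) {k : ℕ} (π : Fin k ↔ Fin (n T))
  (ι : Fin k → Fin (n G)) → Tournament T →
  (∀ u v → arc T (Inverse.to π u) (Inverse.to π v) ≡ true →
           arc G (ι u) (ι v) ≡ true) →
  Iso (induceBy G ι) T
tournamentEmbedding T G π ι tournament arcsPreserved = π , arcsAgree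
  where
  open Inverse π using (to)

  booleanClash : ∀ {A : Set} {b : Bool} → b ≡ true → b ≡ false → A
  booleanClash refl ()

  arcsAgree : ∀ u v → arc T (to u) (to v) ≡ arc G (ι u) (ι v)
  arcsAgree u v with arc T (to u) (to v) in tuv
  ... | true = sym (arcsPreserved u v tuv)
  ... | false with to u ≟ to v
  ...   | yes same = sym (subst (λ w → arc G (ι u) (ι w) ≡ false)
                                (Injection.injective (↔⇒↣ π) same)
                                (irrefl G (ι u)))
  ...   | no different with tournament (to u) (to v) different
  ...     | inj₁ tuv′ = booleanClash tuv′ tuv
  ...     | inj₂ tvu = sym (asym G (ι v) (ι u) (arcsPreserved v u tvu))

transitiveTriangleIsTournament : Tournament nonOrientedTriangle
transitiveTriangleIsTournament zero zero distinct = ⊥-elim (distinct refl)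
transitiveTriangleIsTournament zero (suc zero) _ = inj₁ refl
transitiveTriangleIsTournament zero (suc (suc zero)) _ = inj₁ refl
transitiveTriangleIsTournament (suc zero) zero _ = inj₂ refl
transitiveTriangleIsTournament (suc zero) (suc zero) distinct = ⊥-elim (distinct refl)
transitiveTriangleIsTournament (suc zero) (suc (suc zero)) _ = inj₁ refl
transitiveTriangleIsTournament (suc (suc zero)) zero _ = inj₂ refl
transitiveTriangleIsTournament (suc (suc zero)) (suc zero) _ = inj₂ refl
transitiveTriangleIsTournament (suc (suc zero)) (suc (suc zero)) distinct =
  ⊥-elim (distinct refl)

transitiveTriple : (G : OGraph) (π : Fin 3 ↔ Fin 3) (ι : Fin 3 → Fin (n G)) →
  let open Inverse π using (from) in
  arc G (ι (from zero)) (ι (from (suc zero))) ≡ true →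
  arc G (ι (from zero)) (ι (from (suc (suc zero)))) ≡ true →
  arc G (ι (from (suc zero))) (ι (from (suc (suc zero)))) ≡ true →
  Iso (induceBy G ι) nonOrientedTriangle
transitiveTriple G π ι arc₀₁ arc₀₂ arc₁₂ =
  tournamentEmbedding nonOrientedTriangle G π ι
    transitiveTriangleIsTournament arcsPreserved
  where
  open Inverse π using (to; from; strictlyInverseʳ)

  byRank : ∀ a b → transArc a b ≡ true → arc G (ι (from a)) (ι (from b)) ≡ true
  byRank zero             (suc zero)       _ = arc₀₁
  byRank zero             (suc (suc zero)) _ = arc₀₂
  byRank (suc zero)       (suc (suc zero)) _ = arc₁₂
  byRank zero             zero             ()
  byRank (suc zero)       zero             ()
  byRank (suc zero)       (suc zero)       ()
  byRank (suc (suc zero)) zero             ()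
  byRank (suc (suc zero)) (suc zero)       ()
  byRank (suc (suc zero)) (suc (suc zero)) ()

  arcsPreserved : ∀ u v → transArc (to u) (to v) ≡ true → arc G (ι u) (ι v) ≡ true
  arcsPreserved u v ranked =
    subst₂ (λ x y → arc G (ι x) (ι y) ≡ true) (strictlyInverseʳ u) (strictlyInverseʳ v)
      (byRank (to u) (to v) ranked)

swap₁₂ : Fin 3 → Fin 3
swap₁₂ zero             = zero
swap₁₂ (suc zero)       = suc (suc zero)
swap₁₂ (suc (suc zero)) = suc zero

swap₁₂-involutive : ∀ i → swap₁₂ (swap₁₂ i) ≡ i
swap₁₂-involutive zero             = refl
swap₁₂-involutive (suc zero)       = refl
swap₁₂-involutive (suc (suc zero)) = refl

swap₁₂↔ : Fin 3 ↔ Fin 3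
swap₁₂↔ = mk↔ₛ′ swap₁₂ swap₁₂ swap₁₂-involutive swap₁₂-involutive

countTrue : List Bool → ℕ
countTrue bs = sum (map (λ b → if b then 1 else 0) bs)

twoOfThree : ∀ b₁ b₂ b₃ → 3 ≤ 2 * countTrue (b₁ ∷ b₂ ∷ b₃ ∷ []) →
  (b₁ ≡ true × b₂ ≡ true) ⊎ (b₂ ≡ true × b₃ ≡ true) ⊎ (b₁ ≡ true × b₃ ≡ true)
twoOfThree true  true  _     _ = inj₁ (refl , refl)
twoOfThree false true  true  _ = inj₂ (inj₁ (refl , refl))
twoOfThree true  false true  _ = inj₂ (inj₂ (refl , refl))
twoOfThree true  false false (s≤s (s≤s ()))
twoOfThree false true  false (s≤s (s≤s ()))
twoOfThree false false true  (s≤s (s≤s ()))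
twoOfThree false false false ()

coneArc : (H : OGraph) → Fin (suc (n H)) → Fin (suc (n H)) → Bool
coneArc H zero    zero    = false
coneArc H zero    (suc v) = true
coneArc H (suc u) zero    = false
coneArc H (suc u) (suc v) = arc H u v

cone : OGraph → OGraph
cone H = record { n = suc (n H) ; arc = coneArc H ; irrefl = noLoop ; asym = oneWay }
  where
  noLoop : ∀ v → coneArc H v v ≡ false
  noLoop zero    = refl
  noLoop (suc v) = irrefl H v

  oneWay : ∀ u v → coneArc H u v ≡ true → coneArc H v u ≡ false
  oneWay zero    (suc v) _   = refl
  oneWay (suc u) (suc v) uv  = asym H u v uv

coneOverTriangle : OGraph
coneOverTriangle = cone orientedTriangle

apex : Subset 4
apex = ⁅ zero ⁆

triangleSide : Iso orientedTriangle (induced coneOverTriangle (complement apex))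
triangleSide = ↔-id _ , sameArcs
  where
  sameArcs : ∀ u v → arc (induced coneOverTriangle (complement apex)) u v ≡ cycArc u v
  sameArcs zero             zero             = refl
  sameArcs zero             (suc zero)       = refl
  sameArcs zero             (suc (suc zero)) = refl
  sameArcs (suc zero)       zero             = refl
  sameArcs (suc zero)       (suc zero)       = refl
  sameArcs (suc zero)       (suc (suc zero)) = refl
  sameArcs (suc (suc zero)) zero             = refl
  sameArcs (suc (suc zero)) (suc zero)       = refl
  sameArcs (suc (suc zero)) (suc (suc zero)) = refl

-- The arcs crossing the partition are exactly the three apex arcs, so a
-- choice keep of arcs retains as many crossing arcs as it marks apex arcs.
crossingApexArcs : crossCount coneOverTriangle apex ≡ 3
crossingApexArcs = refl

keptApexArcs : (keep : Fin 4 → Fin 4 → Bool) → keptCount coneOverTriangle apex keep ≡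
  countTrue (keep zero (suc zero) ∷ keep zero (suc (suc zero)) ∷
             keep zero (suc (suc (suc zero))) ∷ [])
keptApexArcs keep = +-identityʳ _

-- An apex arc 0 → v is present in it exactly when
-- keep 0 v is true; the cycle arcs do not cross the partition and stay.
prunedCone : (Fin 4 → Fin 4 → Bool) → OGraph
prunedCone keep = deleteCrossing coneOverTriangle apex keep

-- If the extension step keeps at least half of the three apex arcs, the
-- pruned cone contains an induced transitive triangle: two kept apex arcs
-- together with the cycle arc between their heads (for the heads 1 and 3
-- that arc is 3 → 1, so 3 is ranked before 1).
transitiveTriangleSurvives : (keep : Fin 4 → Fin 4 → Bool) →
  crossCount coneOverTriangle apex ≤ 2 * keptCount coneOverTriangle apex keep →
  ∃ λ (S : Subset 4) → Iso (induced (prunedCone keep) S) nonOrientedTriangle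
transitiveTriangleSurvives keep halfKept
  with twoOfThree _ _ _
         (subst₂ (λ c k → c ≤ 2 * k) crossingApexArcs (keptApexArcs keep) halfKept)
... | inj₁ (keep₁ , keep₂) =
  let S = true ∷ true ∷ true ∷ false ∷ [] in
  S , transitiveTriple (prunedCone keep) (↔-id _) (select S) keep₁ keep₂ refl
... | inj₂ (inj₁ (keep₂ , keep₃)) =
  let S = true ∷ false ∷ true ∷ true ∷ [] in
  S , transitiveTriple (prunedCone keep) (↔-id _) (select S) keep₂ keep₃ refl
... | inj₂ (inj₂ (keep₁ , keep₃)) =
  let S = true ∷ true ∷ false ∷ true ∷ [] in
  S , transitiveTriple (prunedCone keep) swap₁₂↔ (select S) keep₃ keep₁ refl

mainTheorem6 : (Π : GraphProperty) → StronglyHalfExtendible Π → Hereditary Π →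
    Π orientedTriangle → Π nonOrientedTriangle
mainTheorem6 Π (isoClosed , (singletons , _) , _ , extension) hereditary triangle
  with extension coneOverTriangle apex (singletons _ refl)
                 (isoClosed _ _ triangleSide triangle)
... | keep , halfKept , prunedInΠ
  with transitiveTriangleSurvives keep halfKept
... | S , transitive = isoClosed _ _ transitive (hereditary (prunedCone keep) S prunedInΠ)
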